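{- For every real $\lambda>1$ there do not exist positive constants $\alpha$ and $C$ with the following property: for all positive integers $p\le n$, every set $K$ of at least $\lambda^p$ vectors in $\{0,1\}^n$, each of Hamming weight $p$, contains a subset $K'$ with $|K'|\ge |K|^{\alpha}$ and ${\rm dr}(K')\le C$. Equivalently: for all reals $\alpha>0$, $C>0$ and $\lambda>1$ there exist positive integers $p\le n$ and a set $K$ of at least $\lambda^p$ vectors in $\{0,1\}^n$, each of Hamming weight $p$, such that no subset $K'\subseteq K$ with $|K'|\ge |K|^{\alpha}$ satisfies ${\rm dr}(K')\le C$.
   Context: The Hamming weight $|v|$ of $v\in\{0,1\}^n$ is the sum of its coordinates. The Hamming distance $\rho(u,v)$ between $u,v\in\{0,1\}^n$ is the number of coordinates in which they differ. For a set $L\subseteq\{0,1\}^n$ with at least two elements, the distance ratio is ${\rm dr}(L)=\max\{\rho(x,y): x,y\in L\}/\min\{\rho(x,y): x,y\in L,\ x\ne y\}$. A set with fewer than two elements is not considered to satisfy ${\rm dr}\le C$.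
   Formalization: The constants λ>1, α>0 and C>0 are taken to be rationals rather than reals. -}

module Defs where

open import Data.Nat using (ℕ; zero; suc; _+_; _*_; _≤_)
open import Data.Bool using (Bool; true; false)
open import Data.Vec using (Vec; []; _∷_)
open import Data.List using (List; length)
open import Data.List.Membership.Propositional using (_∈_)
open import Data.Product using (_×_)
open import Relation.Binary.PropositionalEquality using (_≡_; _≢_)

weight : ∀ {n} → Vec Bool n → ℕ
weight [] = 0
weight (true ∷ v) = suc (weight v)
weight (false ∷ v) = weight v

ρ : ∀ {n} → Vec Bool n → Vec Bool n → ℕ
ρ [] [] = 0
ρ (true ∷ u) (true ∷ v) = ρ u v
ρ (false ∷ u) (false ∷ v) = ρ u v
ρ (true ∷ u) (false ∷ v) = suc (ρ u v)
ρ (false ∷ u) (true ∷ v) = suc (ρ u v)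

-- dr(L) ≤ c/d  for a duplicate-free list L (a finite set):
-- L has at least two elements and  max ρ / min_{x≠y} ρ ≤ c/d,
-- i.e. every distance, times d, is at most c times every nonzero distance
-- between distinct elements.
DrLe : ∀ {n} → ℕ → ℕ → List (Vec Bool n) → Set
DrLe {n} c d L =
  (2 ≤ length L) ×
  (∀ (x y z w : Vec Bool n) → x ∈ L → y ∈ L → z ∈ L → w ∈ L → z ≢ w →
     d * ρ x y ≤ c * ρ z w)

-- Given λ = r/s > 1 and candidate constants α = a/b, C = c/d, we build a
-- hierarchical code K h ⊆ {0,1}^(N h) of constant weight P h and size t^h.
-- A word of K (h+1) is a "top block" followed by a word of K h; the top block
-- is one of t one-hot vectors repeated W h times, where W h exceeds c times
-- the diameter 2·P h of K h.  Hence two words with the same top block are at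
-- distance ≤ 2·P h, while words with different top blocks are at distance
-- ≥ W h > c·2·P h.  So in a set K′ with dr(K′) ≤ c/d, as soon as two words
-- share their top block all words do; stripping that block and recursing
-- shows |K′| ≤ t (cluster lemma and size bound below).
-- Taking h = b+1 and t = r^(P h), the code is dense enough for the
-- hypothesis, yet |K|^a ≥ t^(b+1) > t^b ≥ |K′|^b, contradicting |K|^a ≤ |K′|^b.
module Submission where

open import Defs
open import Data.Nat using (ℕ; zero; suc; _+_; _*_; _^_; _≤_; _<_; z≤n; s≤s; _≤?_; >-nonZero)
open import Data.Nat.Properties
open import Data.Bool using (Bool; true; false)
open import Data.Vec using (Vec; []; _∷_; _++_; replicate; take; drop)
open import Data.Vec.Properties using (++-injectiveˡ; ++-injectiveʳ; ∷-injectiveʳ; take++drop≡id)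
open import Data.Fin using (Fin; zero; suc)
import Data.Fin.Properties as Fin
open import Data.List using (List; []; _∷_; length; map; cartesianProductWith; allFin; lookup)
open import Data.List.Properties using (length-map; length-++; length-tabulate; map-∘; map-id-local)
open import Data.List.Membership.Propositional using (_∈_)
open import Data.List.Membership.Propositional.Properties using (∈-cartesianProductWith⁻; ∈-map⁺; ∈-lookup)
open import Data.List.Relation.Unary.All as All using (All; []; _∷_)
import Data.List.Relation.Unary.All.Properties as All
open import Data.List.Relation.Unary.Any using (here)
open import Data.List.Relation.Unary.AllPairs using ([]; _∷_)
open import Data.List.Relation.Unary.Unique.Propositional using (Unique)
import Data.List.Relation.Unary.Unique.Propositional.Properties as Unique
open import Data.Product using (Σ; ∃; ∃-syntax; _×_; _,_; proj₁)
open import Relation.Binary.PropositionalEquality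
open import Relation.Nullary using (¬_; yes; no)
open import Data.Empty using (⊥-elim)

weight-++ : ∀ {m n} (x : Vec Bool m) (y : Vec Bool n) → weight (x ++ y) ≡ weight x + weight y
weight-++ [] y = refl
weight-++ (true ∷ x) y = cong suc (weight-++ x y)
weight-++ (false ∷ x) y = weight-++ x y

ρ-++ : ∀ {m n} (x x′ : Vec Bool m) (y y′ : Vec Bool n) → ρ (x ++ y) (x′ ++ y′) ≡ ρ x x′ + ρ y y′
ρ-++ [] [] y y′ = refl
ρ-++ (true ∷ x) (true ∷ x′) y y′ = ρ-++ x x′ y y′
ρ-++ (true ∷ x) (false ∷ x′) y y′ = cong suc (ρ-++ x x′ y y′)
ρ-++ (false ∷ x) (true ∷ x′) y y′ = cong suc (ρ-++ x x′ y y′)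
ρ-++ (false ∷ x) (false ∷ x′) y y′ = ρ-++ x x′ y y′

ρ-self : ∀ {n} (x : Vec Bool n) → ρ x x ≡ 0
ρ-self [] = refl
ρ-self (true ∷ x) = ρ-self x
ρ-self (false ∷ x) = ρ-self x

ρ-common-prefix : ∀ {m n} (u : Vec Bool m) (x y : Vec Bool n) → ρ (u ++ x) (u ++ y) ≡ ρ x y
ρ-common-prefix u x y = trans (ρ-++ u u x y) (cong (_+ ρ x y) (ρ-self u))

ρ-positive : ∀ {n} {x y : Vec Bool n} → x ≢ y → 1 ≤ ρ x y
ρ-positive {x = []} {[]} x≢y = ⊥-elim (x≢y refl)
ρ-positive {x = true ∷ x} {true ∷ y} x≢y = ρ-positive (λ x≡y → x≢y (cong (true ∷_) x≡y))
ρ-positive {x = false ∷ x} {false ∷ y} x≢y = ρ-positive (λ x≡y → x≢y (cong (false ∷_) x≡y))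
ρ-positive {x = true ∷ x} {false ∷ y} _ = s≤s z≤n
ρ-positive {x = false ∷ x} {true ∷ y} _ = s≤s z≤n

-- The distance is at most the sum of the weights (triangle inequality via 0).
ρ≤weight+weight : ∀ {n} (x y : Vec Bool n) → ρ x y ≤ weight x + weight y
ρ≤weight+weight [] [] = z≤n
ρ≤weight+weight (true ∷ x) (true ∷ y) =
  m≤n⇒m≤1+n (≤-trans (ρ≤weight+weight x y) (+-monoʳ-≤ (weight x) (n≤1+n _)))
ρ≤weight+weight (true ∷ x) (false ∷ y) = s≤s (ρ≤weight+weight x y)
ρ≤weight+weight (false ∷ x) (true ∷ y) =
  ≤-trans (s≤s (ρ≤weight+weight x y)) (≤-reflexive (sym (+-suc (weight x) (weight y))))
ρ≤weight+weight (false ∷ x) (false ∷ y) = ρ≤weight+weight x y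

copies : ∀ {m} (w : ℕ) → Vec Bool m → Vec Bool (w * m)
copies zero x = []
copies (suc w) x = x ++ copies w x

weight-copies : ∀ {m} w (x : Vec Bool m) → weight (copies w x) ≡ w * weight x
weight-copies zero x = refl
weight-copies (suc w) x = trans (weight-++ x (copies w x)) (cong (weight x +_) (weight-copies w x))

ρ-copies : ∀ {m} w (x y : Vec Bool m) → ρ (copies w x) (copies w y) ≡ w * ρ x y
ρ-copies zero x y = refl
ρ-copies (suc w) x y = trans (ρ-++ x y (copies w x) (copies w y)) (cong (ρ x y +_) (ρ-copies w x y))

onehot : ∀ {n} → Fin n → Vec Bool n
onehot {suc n} zero = true ∷ replicate n false
onehot (suc j) = false ∷ onehot j

weight-onehot : ∀ {n} (j : Fin n) → weight (onehot j) ≡ 1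
weight-onehot {suc n} zero = cong suc (weight-zeros n)
  where
  weight-zeros : ∀ k → weight (replicate k false) ≡ 0
  weight-zeros zero = refl
  weight-zeros (suc k) = weight-zeros k
weight-onehot (suc j) = weight-onehot j

onehot-injective : ∀ {n} {i j : Fin n} → onehot i ≡ onehot j → i ≡ j
onehot-injective {i = zero} {zero} _ = refl
onehot-injective {i = suc i} {suc j} e = cong suc (onehot-injective (∷-injectiveʳ e))
onehot-injective {suc n} {i = zero} {suc j} ()
onehot-injective {suc n} {i = suc i} {zero} ()

drop-++ : ∀ {A : Set} {m n} (xs : Vec A m) (ys : Vec A n) → drop m (xs ++ ys) ≡ ys
drop-++ {m = m} xs ys =
  sym (++-injectiveʳ xs (take m (xs ++ ys)) (sym (take++drop≡id m (xs ++ ys))))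

RatioBound : ∀ {n} → ℕ → ℕ → List (Vec Bool n) → Set
RatioBound {n} c d L =
  ∀ (x y z w : Vec Bool n) → x ∈ L → y ∈ L → z ∈ L → w ∈ L → z ≢ w →
    d * ρ x y ≤ c * ρ z w

RatioBound-unprefix : ∀ {m n} c d (u : Vec Bool m) (L : List (Vec Bool n)) →
  RatioBound c d (map (u ++_) L) → RatioBound c d L
RatioBound-unprefix c d u L bound x y z w x∈ y∈ z∈ w∈ z≢w =
  subst₂ (λ p q → d * p ≤ c * q) (ρ-common-prefix u x y) (ρ-common-prefix u z w)
    (bound _ _ _ _ (∈-map⁺ _ x∈) (∈-map⁺ _ y∈) (∈-map⁺ _ z∈) (∈-map⁺ _ w∈)
      (λ e → z≢w (++-injectiveʳ u u e)))

factor-prefix : ∀ {m n} (u : Vec Bool m) (L : List (Vec Bool (m + n))) →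
  All (λ z → z ≡ u ++ drop m z) L → map (u ++_) (map (drop m) L) ≡ L
factor-prefix u L prefixed =
  trans (sym (map-∘ L)) (map-id-local (All.map sym prefixed))

-- There is only one word of length 0, so a duplicate-free list of them is short.
unique-length≤1 : ∀ {A : Set} (L : List (Vec A 0)) → Unique L → length L ≤ 1
unique-length≤1 [] _ = z≤n
unique-length≤1 (_ ∷ []) _ = s≤s z≤n
unique-length≤1 ([] ∷ [] ∷ _) ((x≢y ∷ _) ∷ _) = ⊥-elim (x≢y refl)

lookup-distinct : ∀ {A : Set} {xs : List A} → Unique xs →
  ∀ {i j : Fin (length xs)} → i Data.Fin.< j → lookup xs i ≢ lookup xs j
lookup-distinct (x∉ ∷ _) {zero} {suc j} _ = All.lookup x∉ (∈-lookup j)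
lookup-distinct (_ ∷ u) {suc i} {suc j} (s≤s i<j) = lookup-distinct u i<j

length-cartesianProductWith : ∀ {A B C : Set} (f : A → B → C) (xs : List A) (ys : List B) →
  length (cartesianProductWith f xs ys) ≡ length xs * length ys
length-cartesianProductWith f [] ys = refl
length-cartesianProductWith f (x ∷ xs) ys =
  trans (length-++ (map (f x) ys))
    (cong₂ _+_ (length-map (f x) ys) (length-cartesianProductWith f xs ys))

1≤power : ∀ {x} k → 1 ≤ x → 1 ≤ x ^ k
1≤power {x} k 1≤x = subst (_≤ x ^ k) (^-zeroˡ k) (^-monoˡ-≤ k 1≤x)

base≤power : ∀ {x k} → 1 ≤ k → 1 ≤ x → x ≤ x ^ k
base≤power {x} {suc k} _ 1≤x =
  ≤-trans (≤-reflexive (sym (*-identityʳ x))) (*-monoʳ-≤ x (1≤power k 1≤x))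

no-polynomial-gain : ∀ {t m a} b → 1 ≤ a → 1 < t → m ≤ t → ¬ ((t ^ suc b) ^ a ≤ m ^ b)
no-polynomial-gain {t} {m} {a} b 1≤a 1<t m≤t gain = <-irrefl refl (begin-strict
  (t ^ suc b) ^ a  ≤⟨ gain ⟩
  m ^ b            ≤⟨ ^-monoˡ-≤ b m≤t ⟩
  t ^ b            <⟨ ^-monoʳ-< t 1<t (n<1+n b) ⟩
  t ^ suc b        ≤⟨ base≤power 1≤a (1≤power (suc b) (<⇒≤ 1<t)) ⟩
  (t ^ suc b) ^ a  ∎)
  where open ≤-Reasoning

-- P h is the weight of the level-h code and W h the number of repetitions
-- of its top block; W h exceeds c times 2·P h, the diameter of level h.
module Levels (c : ℕ) where
  P W : ℕ → ℕ
  P zero = 0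
  P (suc h) = W h + P h
  W h = suc (c * (P h + P h))

module Code (c t : ℕ) where
  open Levels c public

  N : ℕ → ℕ
  N zero = 0
  N (suc h) = W h * t + N h

  block : ∀ h → Fin t → Vec Bool (W h * t)
  block h j = copies (W h) (onehot j)

  -- Different top blocks are different words (their first copies differ).
  block-injective : ∀ h {j k : Fin t} → block h j ≡ block h k → j ≡ k
  block-injective h {j} {k} e = onehot-injective (++-injectiveˡ (onehot j) (onehot k) e)

  K : ∀ h → List (Vec Bool (N h))
  K zero = [] ∷ []
  K (suc h) = cartesianProductWith (λ j v → block h j ++ v) (allFin t) (K h)

  K-length : ∀ h → length (K h) ≡ t ^ h
  K-length zero = refl
  K-length (suc h) =
    trans (length-cartesianProductWith _ (allFin t) (K h))
      (cong₂ _*_ (length-tabulate {n = t} (λ i → i)) (K-length h))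

  K-unique : ∀ h → Unique (K h)
  K-unique zero = [] ∷ []
  K-unique (suc h) = Unique.cartesianProductWith⁺ (λ j v → block h j ++ v)
    (λ {j} {k} e → block-injective h (++-injectiveˡ (block h j) (block h k) e)
                 , ++-injectiveʳ (block h j) (block h k) e)
    (Unique.allFin⁺ t) (K-unique h)

  split : ∀ h {x} → x ∈ K (suc h) →
    ∃[ j ] ∃[ v ] (j ∈ allFin t × v ∈ K h × x ≡ block h j ++ v)
  split h = ∈-cartesianProductWith⁻ (λ j v → block h j ++ v) (allFin t) (K h)

  top : ∀ h {x} → x ∈ K (suc h) → Fin t
  top h x∈ = proj₁ (split h x∈)

  suffix : ∀ h → Vec Bool (N (suc h)) → Vec Bool (N h)
  suffix h = drop (W h * t)

  decompose : ∀ h {x} (x∈ : x ∈ K (suc h)) → x ≡ block h (top h x∈) ++ suffix h x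
  decompose h {x} x∈ =
    let (j , v , _ , _ , x≡) = split h x∈
    in trans x≡ (cong (block h j ++_) (sym (trans (cong (suffix h) x≡) (drop-++ (block h j) v))))

  suffix-∈ : ∀ h {x} → x ∈ K (suc h) → suffix h x ∈ K h
  suffix-∈ h x∈ with split h x∈
  ... | j , v , _ , v∈ , refl = subst (_∈ K h) (sym (drop-++ (block h j) v)) v∈

  K-weight : ∀ h {x} → x ∈ K h → weight x ≡ P h
  K-weight zero (here refl) = refl
  K-weight (suc h) {x} x∈ = begin
    weight x                                ≡⟨ cong weight (decompose h x∈) ⟩
    weight (block h j ++ suffix h x)        ≡⟨ weight-++ (block h j) (suffix h x) ⟩
    weight (block h j) + weight (suffix h x) ≡⟨ cong₂ _+_ block-weight (K-weight h (suffix-∈ h x∈)) ⟩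
    W h + P h                               ∎
    where
    open ≡-Reasoning
    j = top h x∈
    block-weight : weight (block h j) ≡ W h
    block-weight = trans (weight-copies (W h) (onehot j))
      (trans (cong (W h *_) (weight-onehot j)) (*-identityʳ (W h)))

  P≤N : 1 ≤ t → ∀ h → P h ≤ N h
  P≤N 1≤t zero = z≤n
  P≤N 1≤t (suc h) = +-mono-≤ (≤-trans (≤-reflexive (sym (*-identityʳ (W h)))) (*-monoʳ-≤ (W h) 1≤t)) (P≤N 1≤t h)

  same-block-close : ∀ h {x y} (x∈ : x ∈ K (suc h)) (y∈ : y ∈ K (suc h)) →
    top h x∈ ≡ top h y∈ → ρ x y ≤ P h + P h
  same-block-close h {x} {y} x∈ y∈ same = begin
    ρ x y                          ≡⟨ cong₂ ρ (decompose h x∈) y≡ ⟩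
    ρ (u ++ x′) (u ++ y′)          ≡⟨ ρ-common-prefix u x′ y′ ⟩
    ρ x′ y′                        ≤⟨ ρ≤weight+weight x′ y′ ⟩
    weight x′ + weight y′          ≡⟨ cong₂ _+_ (K-weight h (suffix-∈ h x∈)) (K-weight h (suffix-∈ h y∈)) ⟩
    P h + P h                      ∎
    where
    open ≤-Reasoning
    u = block h (top h x∈)
    x′ = suffix h x
    y′ = suffix h y
    y≡ : y ≡ u ++ y′
    y≡ = trans (decompose h y∈) (cong (λ j → block h j ++ y′) (sym same))

  different-blocks-far : ∀ h {x y} (x∈ : x ∈ K (suc h)) (y∈ : y ∈ K (suc h)) →
    top h x∈ ≢ top h y∈ → W h ≤ ρ x y
  different-blocks-far h {x} {y} x∈ y∈ differ = begin
    W h                                    ≡⟨ sym (*-identityʳ (W h)) ⟩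
    W h * 1                                ≤⟨ *-monoʳ-≤ (W h) (ρ-positive (λ e → differ (onehot-injective e))) ⟩
    W h * ρ (onehot j) (onehot k)          ≡⟨ sym (ρ-copies (W h) (onehot j) (onehot k)) ⟩
    ρ (block h j) (block h k)              ≤⟨ m≤m+n _ _ ⟩
    ρ (block h j) (block h k) + ρ x′ y′    ≡⟨ sym (ρ-++ (block h j) (block h k) x′ y′) ⟩
    ρ (block h j ++ x′) (block h k ++ y′)  ≡⟨ sym (cong₂ ρ (decompose h x∈) (decompose h y∈)) ⟩
    ρ x y                                  ∎
    where
    open ≤-Reasoning
    j = top h x∈
    k = top h y∈
    x′ = suffix h x
    y′ = suffix h y

  -- Cluster lemma: in a subset of K (h+1) with ratio bound c/d, two distinct
  -- words sharing a top block force every word to carry that block, since a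
  -- word z with another block would give W h ≤ d·ρ z x ≤ c·ρ x y ≤ c·2·P h.
  cluster : ∀ {d} h {L : List (Vec Bool (N (suc h)))} → 1 ≤ d → RatioBound c d L →
    (sub : All (_∈ K (suc h)) L) → ∀ {x y} → x ∈ L → y ∈ L → x ≢ y →
    (x∈ : x ∈ K (suc h)) (y∈ : y ∈ K (suc h)) → top h x∈ ≡ top h y∈ →
    All (λ z → z ≡ block h (top h x∈) ++ suffix h z) L
  cluster {d} h {L} 1≤d bound sub {x} {y} x∈L y∈L x≢y x∈ y∈ same = All.tabulate on-block
    where
    on-block : ∀ {z} → z ∈ L → z ≡ block h (top h x∈) ++ suffix h z
    on-block {z} z∈L with top h (All.lookup sub z∈L) Fin.≟ top h x∈
    ... | yes same-z = subst (λ j → z ≡ block h j ++ suffix h z) same-z (decompose h (All.lookup sub z∈L))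
    ... | no differ = ⊥-elim (<-irrefl refl (begin-strict
      W h            ≤⟨ different-blocks-far h (All.lookup sub z∈L) x∈ differ ⟩
      ρ z x          ≤⟨ m≤n*m (ρ z x) d {{>-nonZero 1≤d}} ⟩
      d * ρ z x      ≤⟨ bound z x x y z∈L x∈L x∈L y∈L x≢y ⟩
      c * ρ x y      ≤⟨ *-monoʳ-≤ c (same-block-close h x∈ y∈ same) ⟩
      c * (P h + P h) <⟨ n<1+n _ ⟩
      W h            ∎))
      where open ≤-Reasoning

  -- Either its top blocks are distinct, or by pigeonhole two
  -- coincide, the cluster lemma puts it inside one block, and we recurse.
  size-bound : 1 ≤ t → ∀ {d} → 1 ≤ d → ∀ h (L : List (Vec Bool (N h))) →
    Unique L → All (_∈ K h) L → RatioBound c d L → length L ≤ t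
  size-bound 1≤t _ zero L unique _ _ = ≤-trans (unique-length≤1 L unique) 1≤t
  size-bound 1≤t {d} 1≤d (suc h) L unique sub bound with length L ≤? t
  ... | yes short = short
  ... | no long with Fin.pigeonhole (≰⇒> long) (λ i → top h (All.lookup sub (∈-lookup i)))
  ... | i , i′ , i<i′ , same =
    subst (_≤ t) (length-map (suffix h) L) (size-bound 1≤t 1≤d h L′ unique′ sub′ bound′)
    where
    member : ∀ i → lookup L i ∈ K (suc h)
    member i = All.lookup sub (∈-lookup i)
    u = block h (top h (member i))
    L′ = map (suffix h) L
    L≡ : map (u ++_) L′ ≡ L
    L≡ = factor-prefix u L (cluster h 1≤d bound sub (∈-lookup i) (∈-lookup i′)
           (lookup-distinct unique i<i′) (member i) (member i′) same)
    unique′ : Unique L′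
    unique′ = Unique.map⁻ (subst Unique (sym L≡) unique)
    sub′ : All (_∈ K h) L′
    sub′ = All.map⁺ (All.map (suffix-∈ h) sub)
    bound′ : RatioBound c d L′
    bound′ = RatioBound-unprefix c d u L′ (subst (RatioBound c d) (sym L≡) bound)

  no-large-subset : 1 < t → ∀ {a d} b → 1 ≤ a → 1 ≤ d →
    ¬ (∃ λ (K′ : List (Vec Bool (N (suc b)))) →
         Unique K′ × All (_∈ K (suc b)) K′ ×
         length (K (suc b)) ^ a ≤ length K′ ^ b × DrLe c d K′)
  no-large-subset 1<t {a} b 1≤a 1≤d (K′ , unique , sub , gain , _ , bound) =
    no-polynomial-gain b 1≤a 1<t (size-bound (<⇒≤ 1<t) 1≤d (suc b) K′ unique sub bound)
      (subst (λ k → k ^ a ≤ length K′ ^ b) (K-length (suc b)) gain)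

theorem1 : (r s : ℕ) → 1 ≤ s → s < r →
    ¬ (Σ ℕ λ a → Σ ℕ λ b → Σ ℕ λ c → Σ ℕ λ d →
         1 ≤ a × 1 ≤ b × 1 ≤ c × 1 ≤ d ×
         ((p n : ℕ) → 1 ≤ p → p ≤ n →
          (K : List (Vec Bool n)) → Unique K → All (λ v → weight v ≡ p) K →
          r ^ p ≤ length K * s ^ p →
          ∃ λ (K′ : List (Vec Bool n)) →
            Unique K′ × All (λ v → v ∈ K) K′ ×
            length K ^ a ≤ length K′ ^ b × DrLe c d K′))
theorem1 r s 1≤s s<r (a , b , c , d , 1≤a , _ , _ , 1≤d , property) =
  no-large-subset 1<t {a} b 1≤a 1≤d
    (property p (N h) 1≤p (P≤N (<⇒≤ 1<t) h) (K h) (K-unique h) (All.tabulate (K-weight h)) dense)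
  where
  h = suc b
  p = Levels.P c h
  t = r ^ p
  open Code c t
  1≤p : 1 ≤ p
  1≤p = s≤s z≤n
  1≤r : 1 ≤ r
  1≤r = ≤-trans 1≤s (<⇒≤ s<r)
  1<t : 1 < t
  1<t = <-≤-trans (s≤s 1≤s) (≤-trans s<r (base≤power 1≤p 1≤r))
  -- |K h| = t^h ≥ t = r^p, so the code is dense enough for the hypothesis.
  dense : r ^ p ≤ length (K h) * s ^ p
  dense = begin
    t                     ≤⟨ base≤power {k = h} (s≤s z≤n) (<⇒≤ 1<t) ⟩
    t ^ h                 ≡⟨ sym (K-length h) ⟩
    length (K h)          ≡⟨ sym (*-identityʳ _) ⟩
    length (K h) * 1      ≤⟨ *-monoʳ-≤ (length (K h)) (1≤power p 1≤s) ⟩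
    length (K h) * s ^ p  ∎
    where open ≤-Reasoning
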